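{- Let $\mathcal{R}$ be a finite set of rules, $G$ an attributed graph and $M\subseteq\mathrm{Match}_{\mathcal{R}}(G)$. Then $M$ is regular if and only if every subset of $M$ is regular.
   Context: Fix a many-sorted signature $\Sigma$ and a set $\mathscr{V}$ of sorted variables disjoint from $\Sigma$; $T_\Sigma(X)$ is the term algebra over a finite $X\subseteq\mathscr{V}$, and $|\mathcal{A}|$ denotes the disjoint union of the carriers of a $\Sigma$-algebra $\mathcal{A}$. An attributed graph $G=(V_G,A_G,s_G,t_G,\mathcal{A}_G,l_G)$ consists of sets $V_G$ (vertices) and $A_G$ (arrows), source and target functions $s_G,t_G:A_G\to V_G$, a $\Sigma$-algebra $\mathcal{A}_G$, and an attribution $l_G:V_G\cup A_G\to\mathcal{P}(|\mathcal{A}_G|)$, with $V_G,A_G,|\mathcal{A}_G|$ pairwise disjoint. $H\lhd G$ ($H$ is a subgraph of $G$) if $V_H\subseteq V_G$, $A_H\subseteq A_G$, $s_H,t_H$ are restrictions of $s_G,t_G$, $\mathcal{A}_H=\mathcal{A}_G$, and $l_H(x)\subseteq l_G(x)$ for all $x\in V_H\cup A_H$. A morphism $\alpha:H\to G$ is a function from $V_H\cup A_H\cup|\mathcal{A}_H|$ to $V_G\cup A_G\cup|\mathcal{A}_G|$ mapping vertices to vertices and arrows to arrows with $s_G\circ\alpha=\alpha\circ s_H$, $t_G\circ\alpha=\alpha\circ t_H$, whose restriction $\alpha_{\mathcal{A}}$ to $|\mathcal{A}_H|$ is a $\Sigma$-homomorphism into $\mathcal{A}_G$, and with $\alpha_{\mathcal{A}}(l_H(x))\subseteq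 l_G(\alpha(x))$. A matching is a morphism injective on vertices and arrows. Attributions are combined pointwise, an attribution of a subgraph being extended by $\varnothing$. Graphs $H,G$ are joinable if $\mathcal{A}_H=\mathcal{A}_G$, $V_H\cap A_G=A_H\cap V_G=\varnothing$, and $s_H,s_G$ (resp. $t_H,t_G$) agree on $A_H\cap A_G$; then $H\sqcap G$ has vertices $V_H\cap V_G$, arrows $A_H\cap A_G$, the common source/target maps, algebra $\mathcal{A}_H$ and attribution $l_H\cap l_G$, and $H\sqcup G$ has vertices $V_H\cup V_G$, arrows $A_H\cup A_G$, the joined source/target maps, algebra $\mathcal{A}_H$ and attribution $l_H\cup l_G$; $\bigsqcup_{i}G_i$ is defined likewise for pairwise joinable families with a common algebra. $G$ is disjoint from $V,A,l$ ($V,A$ sets, $l$ an attribution) if $V_G\cap V=\varnothing$, $A_G\cap A=\varnothing$ and $l_G(x)\cap l(x)=\varnothing$ for all $x\in V_G\cup A_G$; $G\setminus(V,A,l)$ denotes the largest subgraph of $G$ disjoint from $V,A,l$. A $(\Sigma,X)$-graph is a finite graph with algebra $T_\Sigma(X)$. A rule is a triple $r=(L,K,R)$ of $(\Sigma,X)$-graphs with $L,R$ joinable, $L\sqcap R\lhd K\lhd L$, and $X$ equal to the set of variables occurring in attributes of $L$. A matching of $r$ in $G$ is a matching $\mu:L\to G$ that is consistent: $\mu_{\mathcal{A}}(l_L(x)\setminus l_K(x))\cap\mu_{\mathcal{A}}(l_K(x))=\varnothing$ for all $x\in V_K\cup A_K$. $\mathcal{R}$ is a finite set of rules whose distinct members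 have distinct left-hand-side carriers; $\mathrm{Match}_{\mathcal{R}}(G)$ is the (disjoint) union of the sets of matchings of its rules in $G$, and for $\mu\in\mathrm{Match}_{\mathcal{R}}(G)$ its rule is written $(L_\mu,K_\mu,R_\mu)$. For such $\mu$ define $\mu^{\uparrow}$ on $R_\mu$: it equals $\mu_{\mathcal{A}}$ on the algebra, $\mu^{\uparrow}(x)=\mu(x)$ if $x\in V_{K_\mu}\cup A_{K_\mu}$, and $\mu^{\uparrow}(x)=(x,\mu)$ (a fresh item) otherwise; $\mu^{\uparrow}(R_\mu)$ is the graph with vertices $\mu(V_{R_\mu}\cap V_{K_\mu})\cup((V_{R_\mu}\setminus V_{K_\mu})\times\{\mu\})$, arrows defined similarly, source $\mu^{\uparrow}\circ s_{R_\mu}\circ(\mu^{\uparrow})^{ -1}$, target likewise, algebra $\mathcal{A}_G$, attribution $\mu_{\mathcal{A}}\circ l_{R_\mu}\circ(\mu^{\uparrow})^{ -1}$. For $M\subseteq\mathrm{Match}_{\mathcal{R}}(G)$ let $V^-_M=\bigcup_{\mu\in M}\mu(V_{L_\mu}\setminus V_{K_\mu})$, $A^-_M=\bigcup_{\mu\in M}\mu(A_{L_\mu}\setminus A_{K_\mu})$, and $l^-_M(x)=\bigcup\{\mu_{\mathcal{A}}(l_{L_\mu}(y)\setminus l_{K_\mu}(y)) : \mu\in M,\ \mu(y)=x\}$, and let $G_M=\big(G\setminus(V^-_M,A^-_M,l^-_M)\big)\sqcup\bigsqcup_{\mu\in M}\mu^{\uparrow}(R_\mu)$. $M$ is regular if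 $G_M$ is disjoint from $V^-_M,A^-_M,l^-_M$. -}

module Defs where

open import Level using (0ℓ)
open import Data.Bool using (Bool; T)
open import Data.Empty using (⊥)
open import Data.Nat using (ℕ)
open import Data.Fin using (Fin)
open import Data.List using (List)
open import Data.List.Relation.Unary.All as All using (All; _∷_)
open import Data.List.Membership.Propositional using (_∈_)
open import Data.Product using (Σ; Σ-syntax; ∃; ∃-syntax; _×_; _,_; proj₁; proj₂)
open import Data.Sum using (_⊎_; inj₁; inj₂)
open import Function using (_⇔_)
open import Relation.Nullary using (¬_; Dec; yes; no)
open import Relation.Nullary.Decidable using (_⊎-dec_)
open import Relation.Unary using (Pred; Decidable; _⊆_)
open import Relation.Binary.PropositionalEquality using (_≡_)

record Signature : Set₁ where
  field
    Sort   : Set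
    Op     : Set
    arity  : Op → List Sort
    result : Op → Sort

-- Everything is relative to a fixed signature Σ and a set 𝒱 of sorted
-- variables (Var, with sorting sortᵛ); 𝒱 is disjoint from Σ by typing.
module AttributedGraphs (Sig : Signature) (Var : Set) (sortᵛ : Var → Signature.Sort Sig) where
  open Signature Sig

  record Algebra : Set₁ where
    field
      Carrier : Sort → Set
      ⟦_⟧     : (f : Op) → All Carrier (arity f) → Carrier (result f)

  ∣_∣ : Algebra → Set
  ∣ 𝒜 ∣ = Σ Sort (Algebra.Carrier 𝒜)

  IsHomomorphism : (𝒜 ℬ : Algebra) → (∀ s → Algebra.Carrier 𝒜 s → Algebra.Carrier ℬ s) → Set
  IsHomomorphism 𝒜 ℬ h =
    ∀ f (args : All (Algebra.Carrier 𝒜) (arity f)) →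
      h (result f) (Algebra.⟦_⟧ 𝒜 f args) ≡ Algebra.⟦_⟧ ℬ f (All.map (λ {s} → h s) args)

  ext : {𝒜 ℬ : Algebra} → (∀ s → Algebra.Carrier 𝒜 s → Algebra.Carrier ℬ s) → ∣ 𝒜 ∣ → ∣ ℬ ∣
  ext h (s , c) = s , h s c

  -- A subset X ⊆ 𝒱 is given by its (boolean) characteristic function.
  data Term (X : Var → Bool) : Sort → Set where
    var : (x : Var) → T (X x) → Term X (sortᵛ x)
    op  : (f : Op) → All (Term X) (arity f) → Term X (result f)

  mutual
    data Occurs {X : Var → Bool} (x : Var) : ∀ {s} → Term X s → Set where
      here   : (p : T (X x)) → Occurs x (var x p)
      inside : ∀ {f} {args : All (Term X) (arity f)} → OccursAll x args → Occurs x (op f args)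

    data OccursAll {X : Var → Bool} (x : Var) : ∀ {ss} → All (Term X) ss → Set where
      head : ∀ {s ss} {τ : Term X s} {τs : All (Term X) ss} → Occurs x τ → OccursAll x (τ ∷ τs)
      tail : ∀ {s ss} {τ : Term X s} {τs : All (Term X) ss} → OccursAll x τs → OccursAll x (τ ∷ τs)

  TermAlgebra : (Var → Bool) → Algebra
  TermAlgebra X = record { Carrier = Term X ; ⟦_⟧ = op }

  Finite : {U : Set} → Pred U 0ℓ → Set
  Finite {U} P = Decidable P × (∃[ xs ] ∀ x → P x → x ∈ xs)

  -- Attributed graphs. All items live in an ambient type I
  -- (sets of vertices/arrows are subsets of I); the algebra's carriers
  -- are a different type, hence disjoint from vertices and arrows.

  record Graph (I : Set) (𝒜 : Algebra) : Set₁ where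
    field
      V : Pred I 0ℓ
      A : Pred I 0ℓ
      s : I → I
      t : I → I
      l : I → Pred ∣ 𝒜 ∣ 0ℓ
    Item : Pred I 0ℓ
    Item x = V x ⊎ A x
  open Graph public

  IsGraph : {I : Set} {𝒜 : Algebra} → Graph I 𝒜 → Set
  IsGraph G =
    (∀ x → V G x → A G x → ⊥) ×
    (∀ a → A G a → V G (s G a)) ×
    (∀ a → A G a → V G (t G a))

  FiniteGraph : {I : Set} {𝒜 : Algebra} → Graph I 𝒜 → Set
  FiniteGraph G = Finite (V G) × Finite (A G)

  _⊲_ : {I : Set} {𝒜 : Algebra} → Graph I 𝒜 → Graph I 𝒜 → Set
  H ⊲ G =
    (V H ⊆ V G) × (A H ⊆ A G) ×
    (∀ a → A H a → s H a ≡ s G a) ×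
    (∀ a → A H a → t H a ≡ t G a) ×
    (∀ x → Item H x → l H x ⊆ l G x)

  Joinable : {I : Set} {𝒜 : Algebra} → Graph I 𝒜 → Graph I 𝒜 → Set
  Joinable H G =
    (∀ x → V H x → A G x → ⊥) ×
    (∀ x → A H x → V G x → ⊥) ×
    (∀ a → A H a → A G a → s H a ≡ s G a) ×
    (∀ a → A H a → A G a → t H a ≡ t G a)

  meet : {I : Set} {𝒜 : Algebra} (H G : Graph I 𝒜) → Joinable H G → Graph I 𝒜
  meet H G _ = record
    { V = λ x → V H x × V G x
    ; A = λ x → A H x × A G x
    ; s = s H
    ; t = t H
    ; l = λ x c → l H x c × l G x c
    }

  DisjointFrom : {I : Set} {𝒜 : Algebra} → Graph I 𝒜 → Pred I 0ℓ → Pred I 0ℓ → (I → Pred ∣ 𝒜 ∣ 0ℓ) → Set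
  DisjointFrom G Vr Ar lr =
    (∀ x → V G x → Vr x → ⊥) ×
    (∀ x → A G x → Ar x → ⊥) ×
    (∀ x → Item G x → ∀ c → l G x c → lr x c → ⊥)

  -- G ∖ (Vr, Ar, lr) : the largest subgraph of G disjoint from Vr, Ar, lr
  -- (arrows with a removed endpoint must be removed too)
  remove : {I : Set} {𝒜 : Algebra} → Graph I 𝒜 → Pred I 0ℓ → Pred I 0ℓ → (I → Pred ∣ 𝒜 ∣ 0ℓ) → Graph I 𝒜
  remove G Vr Ar lr = record
    { V = λ v → V G v × ¬ Vr v
    ; A = λ a → A G a × ¬ Ar a × ¬ Vr (s G a) × ¬ Vr (t G a)
    ; s = s G
    ; t = t G
    ; l = λ x c → l G x c × ¬ lr x c
    }

  record Morphism {I J : Set} {𝒜 ℬ : Algebra} (H : Graph I 𝒜) (G : Graph J ℬ) : Set where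
    field
      map    : I → J
      mapᴬ   : ∀ s → Algebra.Carrier 𝒜 s → Algebra.Carrier ℬ s
      pres-V : ∀ x → V H x → V G (map x)
      pres-A : ∀ x → A H x → A G (map x)
      pres-s : ∀ a → A H a → s G (map a) ≡ map (s H a)
      pres-t : ∀ a → A H a → t G (map a) ≡ map (t H a)
      homo   : IsHomomorphism 𝒜 ℬ mapᴬ
      pres-l : ∀ x → Item H x → ∀ c → l H x c → l G (map x) (ext {𝒜} {ℬ} mapᴬ c)

  record Matching {I J : Set} {𝒜 ℬ : Algebra} (H : Graph I 𝒜) (G : Graph J ℬ) : Set where
    field
      morphism  : Morphism H G
      injective : ∀ x y → Item H x → Item H y → Morphism.map morphism x ≡ Morphism.map morphism y → x ≡ y

  record Rule : Set₁ where
    field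
      RI      : Set
      X       : Var → Bool
      X-fin   : ∃[ xs ] ∀ x → T (X x) → x ∈ xs
      L K R   : Graph RI (TermAlgebra X)
      L-graph : IsGraph L
      K-graph : IsGraph K
      R-graph : IsGraph R
      L-fin   : FiniteGraph L
      K-fin   : FiniteGraph K
      R-fin   : FiniteGraph R
      LR-join : Joinable L R
      L⊓R⊲K   : meet L R LR-join ⊲ K
      K⊲L     : K ⊲ L
      X-vars  : ∀ x → T (X x) ⇔ (∃[ y ] Item L y × (∃[ c ] l L y c × Occurs x (proj₂ c)))

  record RuleMatching (r : Rule) {I : Set} {𝒜 : Algebra} (G : Graph I 𝒜) : Set where
    field
      matching   : Matching (Rule.L r) G
      consistent : ∀ x → Item (Rule.K r) x → ∀ c c' →
                     l (Rule.L r) x c → ¬ l (Rule.K r) x c → l (Rule.K r) x c' →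
                     ext {TermAlgebra (Rule.X r)} {𝒜} (Morphism.mapᴬ (Matching.morphism matching)) c
                       ≡ ext {TermAlgebra (Rule.X r)} {𝒜} (Morphism.mapᴬ (Matching.morphism matching)) c' → ⊥

  module _ {n : ℕ} (ℛ : Fin n → Rule) {I : Set} {𝒜 : Algebra} (G : Graph I 𝒜) where

    Match : Set
    Match = Σ (Fin n) λ i → RuleMatching (ℛ i) G

    ruleOf : Match → Rule
    ruleOf μ = ℛ (proj₁ μ)

    Lof Kof Rof : (μ : Match) → Graph (Rule.RI (ruleOf μ)) (TermAlgebra (Rule.X (ruleOf μ)))
    Lof μ = Rule.L (ruleOf μ)
    Kof μ = Rule.K (ruleOf μ)
    Rof μ = Rule.R (ruleOf μ)

    fun : (μ : Match) → Rule.RI (ruleOf μ) → I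
    fun μ = Morphism.map (Matching.morphism (RuleMatching.matching (proj₂ μ)))

    funᴬ : (μ : Match) → ∣ TermAlgebra (Rule.X (ruleOf μ)) ∣ → ∣ 𝒜 ∣
    funᴬ μ = ext {TermAlgebra (Rule.X (ruleOf μ))} {𝒜}
               (Morphism.mapᴬ (Matching.morphism (RuleMatching.matching (proj₂ μ))))

    Fresh : Set
    Fresh = Σ Match λ μ → Rule.RI (ruleOf μ)

    K-item? : (μ : Match) → Decidable (Item (Kof μ))
    K-item? μ y = proj₁ (proj₁ (Rule.K-fin (ruleOf μ))) y ⊎-dec proj₁ (proj₂ (Rule.K-fin (ruleOf μ))) y

    up : (μ : Match) → Rule.RI (ruleOf μ) → I ⊎ Fresh
    up μ y with K-item? μ y
    ... | yes _ = inj₁ (fun μ y)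
    ... | no _  = inj₂ (μ , y)

    srcM tgtM : I ⊎ Fresh → I ⊎ Fresh
    srcM (inj₁ x)       = inj₁ (s G x)
    srcM (inj₂ (μ , y)) = up μ (s (Rof μ) y)
    tgtM (inj₁ x)       = inj₁ (t G x)
    tgtM (inj₂ (μ , y)) = up μ (t (Rof μ) y)

    lift : Match → Graph (I ⊎ Fresh) 𝒜
    lift μ = record
      { V = λ z → ∃[ y ] V (Rof μ) y × up μ y ≡ z
      ; A = λ z → ∃[ y ] A (Rof μ) y × up μ y ≡ z
      ; s = srcM
      ; t = tgtM
      ; l = λ z c → ∃[ y ] Item (Rof μ) y × up μ y ≡ z × (∃[ τ ] l (Rof μ) y τ × funᴬ μ τ ≡ c)
      }

    embed : Graph I 𝒜 → Graph (I ⊎ Fresh) 𝒜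
    embed H = record
      { V = λ z → ∃[ x ] z ≡ inj₁ x × V H x
      ; A = λ z → ∃[ x ] z ≡ inj₁ x × A H x
      ; s = srcM
      ; t = tgtM
      ; l = λ z c → ∃[ x ] z ≡ inj₁ x × Item H x × l H x c
      }

    V⁻ A⁻ : Pred Match 0ℓ → Pred I 0ℓ
    V⁻ M v = ∃[ μ ] M μ × (∃[ y ] V (Lof μ) y × ¬ V (Kof μ) y × fun μ y ≡ v)
    A⁻ M a = ∃[ μ ] M μ × (∃[ y ] A (Lof μ) y × ¬ A (Kof μ) y × fun μ y ≡ a)

    l⁻ : Pred Match 0ℓ → I → Pred ∣ 𝒜 ∣ 0ℓ
    l⁻ M x c = ∃[ μ ] M μ × (∃[ y ] Item (Lof μ) y × fun μ y ≡ x ×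
                 (∃[ τ ] l (Lof μ) y τ × ¬ l (Kof μ) y τ × funᴬ μ τ ≡ c))

    GM : Pred Match 0ℓ → Graph (I ⊎ Fresh) 𝒜
    GM M = record
      { V = λ z → V G₀ z ⊎ (∃[ μ ] M μ × V (lift μ) z)
      ; A = λ z → A G₀ z ⊎ (∃[ μ ] M μ × A (lift μ) z)
      ; s = srcM
      ; t = tgtM
      ; l = λ z c → l G₀ z c ⊎ (∃[ μ ] M μ × l (lift μ) z c)
      }
      where
        G₀ = embed (remove G (V⁻ M) (A⁻ M) (l⁻ M))

    onOld : Pred I 0ℓ → Pred (I ⊎ Fresh) 0ℓ
    onOld P (inj₁ x) = P x
    onOld P (inj₂ _) = ⊥

    onOldˡ : (I → Pred ∣ 𝒜 ∣ 0ℓ) → (I ⊎ Fresh) → Pred ∣ 𝒜 ∣ 0ℓ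
    onOldˡ P (inj₁ x) c = P x c
    onOldˡ P (inj₂ _) c = ⊥

    Regular : Pred Match 0ℓ → Set
    Regular M = DisjointFrom (GM M) (onOld (V⁻ M)) (onOld (A⁻ M)) (onOldˡ (l⁻ M))

-- In G_M every item is either an untouched
-- item of G, which the removal step makes disjoint from the deleted parts of
-- any subset N, or an item of some μ↑(R_μ) with μ ∈ N; the latter also lies
-- in G_M, and since the deleted parts only grow with N, a clash for N would
-- be a clash for M.
module Submission where

open import Defs
open import Level using (0ℓ)
open import Data.Empty using (⊥)
open import Data.Nat using (ℕ)
open import Data.Fin using (Fin)
open import Data.Product using (_,_; proj₁; proj₂)
open import Data.Sum using (_⊎_; inj₁; inj₂)
open import Function using (_⇔_; mk⇔)
open import Relation.Unary using (Pred; _⊆_)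
open import Relation.Binary.PropositionalEquality using (refl)

module AttributedGraphProperties (Sig : Signature) (Var : Set) (sortᵛ : Var → Signature.Sort Sig) where
  open AttributedGraphs Sig Var sortᵛ

  DisjointFrom-antitone : {J : Set} {𝒜 : Algebra} {H : Graph J 𝒜}
    {Vr Vr′ Ar Ar′ : Pred J 0ℓ} {lr lr′ : J → Pred ∣ 𝒜 ∣ 0ℓ} →
    (∀ x → Vr′ x → Vr x) → (∀ x → Ar′ x → Ar x) → (∀ x → lr′ x ⊆ lr x) →
    DisjointFrom H Vr Ar lr → DisjointFrom H Vr′ Ar′ lr′
  DisjointFrom-antitone V⊆ A⊆ l⊆ (dV , dA , dl) =
    (λ x v r → dV x v (V⊆ x r)) ,
    (λ x a r → dA x a (A⊆ x r)) ,
    (λ x i c l r → dl x i c l (l⊆ x r))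

  module _ {n : ℕ} (ℛ : Fin n → Rule) {I : Set} {𝒜 : Algebra} (G : Graph I 𝒜) where

    Remnant : Pred (Match ℛ G) 0ℓ → Graph I 𝒜
    Remnant M = remove G (V⁻ ℛ G M) (A⁻ ℛ G M) (l⁻ ℛ G M)

    DisjointFromDeleted : Graph (I ⊎ Fresh ℛ G) 𝒜 → Pred (Match ℛ G) 0ℓ → Set
    DisjointFromDeleted H M =
      DisjointFrom H (onOld ℛ G (V⁻ ℛ G M)) (onOld ℛ G (A⁻ ℛ G M)) (onOldˡ ℛ G (l⁻ ℛ G M))

    onOld-mono : {P Q : Pred I 0ℓ} → P ⊆ Q → ∀ z → onOld ℛ G P z → onOld ℛ G Q z
    onOld-mono P⊆Q (inj₁ x) p = P⊆Q p

    onOldˡ-mono : {P Q : I → Pred ∣ 𝒜 ∣ 0ℓ} → (∀ x → P x ⊆ Q x) →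
      ∀ z → onOldˡ ℛ G P z ⊆ onOldˡ ℛ G Q z
    onOldˡ-mono P⊆Q (inj₁ x) p = P⊆Q x p

    module _ {M N : Pred (Match ℛ G) 0ℓ} (N⊆M : N ⊆ M) where

      V⁻-mono : V⁻ ℛ G N ⊆ V⁻ ℛ G M
      V⁻-mono (μ , nμ , deleted) = μ , N⊆M nμ , deleted

      A⁻-mono : A⁻ ℛ G N ⊆ A⁻ ℛ G M
      A⁻-mono (μ , nμ , deleted) = μ , N⊆M nμ , deleted

      l⁻-mono : ∀ x → l⁻ ℛ G N x ⊆ l⁻ ℛ G M x
      l⁻-mono _ (μ , nμ , deleted) = μ , N⊆M nμ , deleted

      DisjointFromDeleted-antitone : {H : Graph (I ⊎ Fresh ℛ G) 𝒜} →
        DisjointFromDeleted H M → DisjointFromDeleted H N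
      DisjointFromDeleted-antitone {H} = DisjointFrom-antitone {H = H}
        (onOld-mono V⁻-mono) (onOld-mono A⁻-mono) (onOldˡ-mono l⁻-mono)

    embed-attributed⇒Item : (H : Graph I 𝒜) {z : I ⊎ Fresh ℛ G} {c : ∣ 𝒜 ∣} →
      l (embed ℛ G H) z c → Item (embed ℛ G H) z
    embed-attributed⇒Item H (x , z≡x , inj₁ v , _) = inj₁ (x , z≡x , v)
    embed-attributed⇒Item H (x , z≡x , inj₂ a , _) = inj₂ (x , z≡x , a)

    lift-attributed⇒Item : (μ : Match ℛ G) {z : I ⊎ Fresh ℛ G} {c : ∣ 𝒜 ∣} →
      l (lift ℛ G μ) z c → Item (lift ℛ G μ) z
    lift-attributed⇒Item μ (y , inj₁ v , up≡z , _) = inj₁ (y , v , up≡z)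
    lift-attributed⇒Item μ (y , inj₂ a , up≡z , _) = inj₂ (y , a , up≡z)

    embed-remove-disjoint : (Vr Ar : Pred I 0ℓ) (lr : I → Pred ∣ 𝒜 ∣ 0ℓ) →
      DisjointFrom (embed ℛ G (remove G Vr Ar lr)) (onOld ℛ G Vr) (onOld ℛ G Ar) (onOldˡ ℛ G lr)
    embed-remove-disjoint Vr Ar lr =
      (λ { _ (x , refl , _ , ¬r) r → ¬r r }) ,
      (λ { _ (x , refl , _ , ¬r , _) r → ¬r r }) ,
      (λ { _ _ c (x , refl , _ , _ , ¬r) r → ¬r r })

    GM-disjoint : (M : Pred (Match ℛ G) 0ℓ) {Vr Ar : Pred (I ⊎ Fresh ℛ G) 0ℓ}
      {lr : I ⊎ Fresh ℛ G → Pred ∣ 𝒜 ∣ 0ℓ} →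
      DisjointFrom (embed ℛ G (Remnant M)) Vr Ar lr →
      (∀ μ → M μ → DisjointFrom (lift ℛ G μ) Vr Ar lr) →
      DisjointFrom (GM ℛ G M) Vr Ar lr
    GM-disjoint M {Vr} {Ar} {lr} (dV , dA , dl) lifts-disjoint = dV′ , dA′ , dl′
      where
      dV′ : ∀ z → V (GM ℛ G M) z → Vr z → ⊥
      dV′ z (inj₁ v) = dV z v
      dV′ z (inj₂ (μ , mμ , v)) = proj₁ (lifts-disjoint μ mμ) z v
      dA′ : ∀ z → A (GM ℛ G M) z → Ar z → ⊥
      dA′ z (inj₁ a) = dA z a
      dA′ z (inj₂ (μ , mμ , a)) = proj₁ (proj₂ (lifts-disjoint μ mμ)) z a
      dl′ : ∀ z → Item (GM ℛ G M) z → ∀ c → l (GM ℛ G M) z c → lr z c → ⊥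
      dl′ z _ c (inj₁ λz) = dl z (embed-attributed⇒Item (Remnant M) λz) c λz
      dl′ z _ c (inj₂ (μ , mμ , λz)) =
        proj₂ (proj₂ (lifts-disjoint μ mμ)) z (lift-attributed⇒Item μ λz) c λz

    Regular⇒lift-disjoint : {M : Pred (Match ℛ G) 0ℓ} → Regular ℛ G M →
      ∀ μ → M μ → DisjointFromDeleted (lift ℛ G μ) M
    Regular⇒lift-disjoint {M} (dV , dA , dl) μ mμ =
      (λ z v → dV z (inj₂ (μ , mμ , v))) ,
      (λ z a → dA z (inj₂ (μ , mμ , a))) ,
      (λ z i c λz → dl z (lift-item⇒GM-item i) c (inj₂ (μ , mμ , λz)))
      where
      lift-item⇒GM-item : ∀ {z} → Item (lift ℛ G μ) z → Item (GM ℛ G M) z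
      lift-item⇒GM-item (inj₁ v) = inj₁ (inj₂ (μ , mμ , v))
      lift-item⇒GM-item (inj₂ a) = inj₂ (inj₂ (μ , mμ , a))

    Regular-antitone : {M N : Pred (Match ℛ G) 0ℓ} → N ⊆ M → Regular ℛ G M → Regular ℛ G N
    Regular-antitone {M} {N} N⊆M regular = GM-disjoint N
      (embed-remove-disjoint (V⁻ ℛ G N) (A⁻ ℛ G N) (l⁻ ℛ G N))
      (λ μ nμ → DisjointFromDeleted-antitone N⊆M {lift ℛ G μ}
                  (Regular⇒lift-disjoint regular μ (N⊆M nμ)))

corollary1 : (Sig : Signature) (Var : Set) (sortᵛ : Var → Signature.Sort Sig) →
    let open AttributedGraphs Sig Var sortᵛ in
    {n : ℕ} (ℛ : Fin n → Rule) {I : Set} (𝒜 : Algebra) (G : Graph I 𝒜) → IsGraph G →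
    (M : Pred (Match ℛ G) 0ℓ) →
    Regular ℛ G M ⇔ (∀ (N : Pred (Match ℛ G) 0ℓ) → N ⊆ M → Regular ℛ G N)
corollary1 Sig Var sortᵛ ℛ 𝒜 G _ M = mk⇔
  (λ regular N N⊆M → Regular-antitone ℛ G (λ {μ} → N⊆M {μ}) regular)
  (λ subsets-regular → subsets-regular M (λ {_} mμ → mμ))
  where open AttributedGraphProperties Sig Var sortᵛ
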